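{- Let $w\in S_n$ avoid the patterns $3412$ and $4231$. Let $d=w^{ -1}(n)$ and $e=w(n)$, and define the sets of positions $B=\{i\mid d<i<n,\ w(i)<e\}$, $C=\{i\mid i<d,\ w(i)>e\}$, $D=\{i\mid d<i<n,\ w(i)>e\}$ (all empty if $w(n)=n$). Then (1) for all $i<j$ in $D$ we have $w(i)>w(j)$; and (2) at least one of $B$, $C$ is empty.
   Context: In the rook diagram of $w$ (rooks at boxes $(w(i),i)$, row index increasing downward), $B$, $C$, $D$ are the positions of the rooks lying respectively in the sector right of the rook of the last row and above the rook of the last column, left of the rook of the last row and below the rook of the last column, and right of the rook of the last row and below the rook of the last column. Pattern avoidance: $w$ avoids $\sigma\in S_k$ if no length-$k$ subsequence of $w(1)\cdots w(n)$ has the same relative order as $\sigma$. -}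

module Defs where

open import Data.Nat using (ℕ; suc)
import Data.Nat as ℕ
open import Data.Fin using (Fin; zero; suc; _<_; toℕ)
open import Data.Product using (Σ; _×_; ∃)
open import Data.Vec using (Vec; []; _∷_; lookup)
open import Relation.Nullary using (¬_)
open import Function.Bundles using (_↔_; _⇔_; Inverse)

-- A permutation w ∈ S_n, acting on positions/values Fin n (0-based:
-- the paper's position/value k corresponds to Fin element k-1).
Perm : ℕ → Set
Perm n = Fin n ↔ Fin n

-- A pattern σ ∈ S_k given in one-line notation σ(1)…σ(k) as a vector of naturals.
-- w contains σ if some subsequence w(f 0) … w(f (k-1)) (f strictly increasing)
-- has the same relative order as σ.
Contains : ∀ {n k} → Perm n → Vec ℕ k → Set
Contains {n} {k} w σ =
  Σ (Fin k → Fin n) λ f →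
    (∀ a b → a < b → f a < f b) ×
    (∀ a b → (lookup σ a ℕ.< lookup σ b) ⇔ (Inverse.to w (f a) < Inverse.to w (f b)))

Avoids : ∀ {n k} → Perm n → Vec ℕ k → Set
Avoids w σ = ¬ Contains w σ

p3412 : Vec ℕ 4
p3412 = 3 ∷ 4 ∷ 1 ∷ 2 ∷ []

p4231 : Vec ℕ 4
p4231 = 4 ∷ 2 ∷ 3 ∷ 1 ∷ []

module Submission where

-- Let N be the last position (and the largest value), d = w⁻¹(N)
-- and e = w(N).  Both claims are pattern-avoidance arguments:
--   (1) if i < j in D had w(i) < w(j), the positions d < i < j < N would carry
--       the values N, w(i), w(j), e, an occurrence of 4231;
--   (2) if k ∈ C and i ∈ B, the positions k < d < i < N would carry the values
--       w(k), N, w(i), e, an occurrence of 3412.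
-- The work is to certify such occurrences without case tables.  A length-k
-- pattern is described by its rank function (the value at each position) and
-- the inverse of that function (the position holding each value).  A map on
-- Fin k that ascends at every consecutive step is strictly monotone, and
-- therefore reflects the order as well; so an occurrence of a pattern is
-- witnessed by two ascending chains: one of positions, and one of the values
-- read off in increasing pattern order.

open import Defs
open import Data.Nat using (ℕ; suc)
import Data.Nat as ℕ
open import Data.Fin using (Fin; _<_; _>_; fromℕ; zero; suc; toℕ; inject₁)
open import Data.Fin.Properties
  using (<-trans; <-asym; <-irrefl; <-cmp; ≤fromℕ; ≤∧≢⇒<; <⇒≢; any?; _<?_)
open import Data.Product using (_×_; ∃; _,_)
open import Data.Sum using (_⊎_; inj₁; inj₂)
open import Data.Empty using (⊥-elim)
open import Data.Vec using (Vec; []; _∷_; lookup)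
open import Relation.Nullary using (¬_; yes; no)
open import Relation.Nullary.Decidable using (_×-dec_)
open import Relation.Binary using (tri<; tri≈; tri>)
open import Relation.Binary.PropositionalEquality
  using (_≡_; _≢_; refl; cong; sym; trans; subst₂)
open import Function using (_∘_)
open import Function.Bundles using (Inverse; Equivalence; _⇔_; mk⇔)

Ascending : ∀ {k n} → (Fin (suc k) → Fin n) → Set
Ascending {k} g = ∀ (i : Fin k) → g (inject₁ i) < g (suc i)

ascending⇒monotone : ∀ {k n} (g : Fin (suc k) → Fin n) → Ascending g →
  ∀ {a b} → a < b → g a < g b
ascending⇒monotone g asc {zero} {suc zero} _ = asc zero
ascending⇒monotone {suc k} g asc {zero} {suc (suc b)} _ =
  <-trans (asc zero) (ascending⇒monotone (g ∘ suc) (asc ∘ suc) {zero} {suc b} (ℕ.s≤s ℕ.z≤n))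
ascending⇒monotone {suc k} g asc {suc a} {suc b} (ℕ.s≤s a<b) =
  ascending⇒monotone (g ∘ suc) (asc ∘ suc) a<b

monotone-reflects : ∀ {k n} (g : Fin k → Fin n) → (∀ {a b} → a < b → g a < g b) →
  ∀ a b → g a < g b → a < b
monotone-reflects g mono a b ga<gb with <-cmp a b
... | tri< a<b _ _ = a<b
... | tri≈ _ refl _ = ⊥-elim (<-irrefl refl ga<gb)
... | tri> _ _ b<a = ⊥-elim (<-asym ga<gb (mono b<a))

record PatternShape {k : ℕ} (σ : Vec ℕ k) : Set where
  field
    rank          : Fin k → Fin k
    position      : Fin k → Fin k
    rank-spec     : ∀ a → suc (toℕ (rank a)) ≡ lookup σ a
    position-rank : ∀ a → position (rank a) ≡ a

  rank-order : ∀ a b → (lookup σ a ℕ.< lookup σ b) ⇔ (rank a < rank b)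
  rank-order a b = mk⇔
    (λ h → ℕ.s<s⁻¹ (subst₂ ℕ._<_ (sym (rank-spec a)) (sym (rank-spec b)) h))
    (λ h → subst₂ ℕ._<_ (rank-spec a) (rank-spec b) (ℕ.s≤s h))

contains-by-chains : ∀ {n k} (w : Perm n) {σ : Vec ℕ (suc k)} (shape : PatternShape σ)
  (f : Fin (suc k) → Fin n) → Ascending f →
  Ascending (Inverse.to w ∘ f ∘ PatternShape.position shape) → Contains w σ
contains-by-chains w {σ} shape f f-asc values-asc =
  f , (λ a b → ascending⇒monotone f f-asc) , order
  where
  open PatternShape shape
  v = Inverse.to w ∘ f
  byRank = v ∘ position
  byRank-mono : ∀ {a b} → a < b → byRank a < byRank b
  byRank-mono = ascending⇒monotone byRank values-asc
  value-at : ∀ a → byRank (rank a) ≡ v a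
  value-at a = cong v (position-rank a)
  order : ∀ a b → (lookup σ a ℕ.< lookup σ b) ⇔ (v a < v b)
  order a b = mk⇔
    (λ h → subst₂ _<_ (value-at a) (value-at b) (byRank-mono (Equivalence.to (rank-order a b) h)))
    (λ h → Equivalence.from (rank-order a b)
      (monotone-reflects byRank byRank-mono (rank a) (rank b)
        (subst₂ _<_ (sym (value-at a)) (sym (value-at b)) h)))

-- 3412 and 4231 are involutions, so each is its own rank and position map.
shape3412 : PatternShape p3412
shape3412 = record
  { rank = r ; position = r
  ; rank-spec = λ { zero → refl ; (suc zero) → refl ; (suc (suc zero)) → refl ; (suc (suc (suc zero))) → refl }
  ; position-rank = λ { zero → refl ; (suc zero) → refl ; (suc (suc zero)) → refl ; (suc (suc (suc zero))) → refl } }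
  where
  r : Fin 4 → Fin 4
  r = lookup (suc (suc zero) ∷ suc (suc (suc zero)) ∷ zero ∷ suc zero ∷ [])

shape4231 : PatternShape p4231
shape4231 = record
  { rank = r ; position = r
  ; rank-spec = λ { zero → refl ; (suc zero) → refl ; (suc (suc zero)) → refl ; (suc (suc (suc zero))) → refl }
  ; position-rank = λ { zero → refl ; (suc zero) → refl ; (suc (suc zero)) → refl ; (suc (suc (suc zero))) → refl } }
  where
  r : Fin 4 → Fin 4
  r = lookup (suc (suc (suc zero)) ∷ suc zero ∷ suc (suc zero) ∷ zero ∷ [])

positions : ∀ {n} → Fin n → Fin n → Fin n → Fin n → Fin 4 → Fin n
positions p₀ p₁ p₂ p₃ = lookup (p₀ ∷ p₁ ∷ p₂ ∷ p₃ ∷ [])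

ascending4 : ∀ {n} (g : Fin 4 → Fin n) →
  g zero < g (suc zero) → g (suc zero) < g (suc (suc zero)) →
  g (suc (suc zero)) < g (suc (suc (suc zero))) → Ascending g
ascending4 g s₀ s₁ s₂ zero = s₀
ascending4 g s₀ s₁ s₂ (suc zero) = s₁
ascending4 g s₀ s₁ s₂ (suc (suc zero)) = s₂

contains4 : ∀ {n} (w : Perm n) {σ : Vec ℕ 4} (shape : PatternShape σ) (p₀ p₁ p₂ p₃ : Fin n) →
  p₀ < p₁ → p₁ < p₂ → p₂ < p₃ →
  let v = Inverse.to w ∘ positions p₀ p₁ p₂ p₃ ∘ PatternShape.position shape in
  v zero < v (suc zero) → v (suc zero) < v (suc (suc zero)) →
  v (suc (suc zero)) < v (suc (suc (suc zero))) → Contains w σ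
contains4 w shape p₀ p₁ p₂ p₃ q₀ q₁ q₂ r₀ r₁ r₂ =
  contains-by-chains w shape f (ascending4 f q₀ q₁ q₂)
    (ascending4 (Inverse.to w ∘ f ∘ PatternShape.position shape) r₀ r₁ r₂)
  where
  f : Fin 4 → Fin _
  f = positions p₀ p₁ p₂ p₃

perm-injective : ∀ {n} (w : Perm n) {i j} → Inverse.to w i ≡ Inverse.to w j → i ≡ j
perm-injective w {i} {j} wi≡wj =
  trans (sym (Inverse.strictlyInverseʳ w i))
        (trans (cong (Inverse.from w) wi≡wj) (Inverse.strictlyInverseʳ w j))

below-maximum : ∀ {m} (w : Perm (suc m)) i → i ≢ Inverse.from w (fromℕ m) →
  Inverse.to w i < Inverse.to w (Inverse.from w (fromℕ m))
below-maximum {m} w i i≢d rewrite Inverse.strictlyInverseˡ w (fromℕ m) =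
  ≤∧≢⇒< (≤fromℕ (Inverse.to w i))
        (λ wi≡N → i≢d (trans (sym (Inverse.strictlyInverseʳ w i)) (cong (Inverse.from w) wi≡N)))

lemma6p1 : (m : ℕ) (w : Perm (suc m)) →
    Avoids w p3412 → Avoids w p4231 →
    let W = Inverse.to w
        d = Inverse.from w (fromℕ m)
        e = W (fromℕ m)
    in (∀ i j → d < i → i < fromℕ m → W i > e →
                d < j → j < fromℕ m → W j > e →
                i < j → W i > W j)
       × ((¬ ∃ λ i → d < i × i < fromℕ m × W i < e)
          ⊎ (¬ ∃ λ i → i < d × W i > e))
lemma6p1 m w avoids3412 avoids4231 = D-decreasing , B-or-C-empty
  where
  W = Inverse.to w
  N = fromℕ m
  d = Inverse.from w N
  e = W N
  -- (1) An increase inside D would complete a 4231 at positions d < i < j < N.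
  D-decreasing : ∀ i j → d < i → i < N → W i > e → d < j → j < N → W j > e → i < j → W i > W j
  D-decreasing i j d<i _ e<Wi d<j j<N _ i<j with <-cmp (W i) (W j)
  ... | tri> _ _ Wj<Wi = Wj<Wi
  ... | tri≈ _ Wi≡Wj _ = ⊥-elim (<⇒≢ i<j (perm-injective w Wi≡Wj))
  ... | tri< Wi<Wj _ _ = ⊥-elim (avoids4231 (contains4 w shape4231 d i j N d<i i<j j<N
        e<Wi Wi<Wj (below-maximum w j (λ j≡d → <⇒≢ d<j (sym j≡d)))))
  -- (2) If B has an element i, any k ∈ C completes a 3412 at positions k < d < i < N.
  B-or-C-empty : (¬ ∃ λ i → d < i × i < N × W i < e) ⊎ (¬ ∃ λ i → i < d × W i > e)
  B-or-C-empty with any? (λ i → (d <? i) ×-dec ((i <? N) ×-dec (W i <? e)))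
  ... | no B-empty = inj₁ B-empty
  ... | yes (i , d<i , i<N , Wi<e) = inj₂ λ { (k , k<d , e<Wk) →
        avoids3412 (contains4 w shape3412 k d i N k<d d<i i<N
          Wi<e e<Wk (below-maximum w k (<⇒≢ k<d))) }
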